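{- Let $(S,\nabla)$ be a divergence Kleene algebra and $a,b\in S$ such that $a$ d-quasi-commutes over $b$, i.e. $|b\rangle|a\rangle\le|a\rangle|(a+b)^*\rangle$. If $a$ is Noetherian then $b^*a$ is Noetherian.
   Context: An idempotent semiring is a structure $(S,+,\cdot,0,1)$ such that $(S,+,0)$ is a commutative monoid with $a+a=a$, $(S,\cdot,1)$ is a monoid, multiplication distributes over addition from both sides, and $0a=a0=0$; natural order $a\le b\iff a+b=b$. A test is an element $p\le 1$ for which some $q$ satisfies $p+q=1$ and $pq=0=qp$; $q$ is unique, written $\neg p$; tests form a Boolean algebra $\mathrm{test}(S)$; $p-q=p\cdot\neg q$. $S$ is a modal semiring if for each $a\in S$ there are maps $|a\rangle,\langle a|$ on $\mathrm{test}(S)$ with, for all $a,b,p,q$: $|a\rangle p\le q\iff \neg q\,a\,p\le 0$; $\langle a|p\le q\iff p\,a\,\neg q\le 0$; $|ab\rangle p=|a\rangle(|b\rangle p)$; $\langle ab|p=\langle b|(\langle a|p)$. Maps on tests are ordered pointwise, juxtaposition is composition. A Kleene algebra is an idempotent semiring with ${}^*$ such that $1+aa^*\le a^*$, $b+ac\le c\Rightarrow a^*b\le c$, $1+a^*a\le a^*$, $b+ca\le c\Rightarrow ba^*\le c$. An element $c$ is Noetherian if for all tests $p$, $p-|c\rangle p\le 0$ implies $p\le 0$. A test $\nabla a$ is the divergence of $a$ if $\nabla a\le|a\rangle\nabla a$ and for every test $p$, $p\le|a\rangle p\Rightarrow p\le\nabla a$. A divergence Kleene algebra is a Kleene algebra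 that is a modal semiring in which $\nabla a$ exists for every $a$. -}

module Defs where

open import Level using (Level; suc)
open import Data.Product using (Σ; _×_; _,_; proj₁; ∃)
open import Function using (_⇔_)
open import Relation.Binary.PropositionalEquality using (_≡_)

record DivergenceKleeneAlgebra (c : Level) : Set (suc c) where
  infixl 6 _+_
  infixl 7 _·_
  infix 4 _≤_
  field
    S   : Set c
    _+_ : S → S → S
    _·_ : S → S → S
    0#  : S
    1#  : S
    _⋆  : S → S
    +-assoc  : ∀ a b c → (a + b) + c ≡ a + (b + c)
    +-comm   : ∀ a b → a + b ≡ b + a
    +-identˡ : ∀ a → 0# + a ≡ a
    +-idem   : ∀ a → a + a ≡ a
    ·-assoc  : ∀ a b c → (a · b) · c ≡ a · (b · c)
    ·-identˡ : ∀ a → 1# · a ≡ a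
    ·-identʳ : ∀ a → a · 1# ≡ a
    distribˡ : ∀ a b c → a · (b + c) ≡ a · b + a · c
    distribʳ : ∀ a b c → (b + c) · a ≡ b · a + c · a
    zeroˡ    : ∀ a → 0# · a ≡ 0#
    zeroʳ    : ∀ a → a · 0# ≡ 0#

  _≤_ : S → S → Set c
  a ≤ b = a + b ≡ b

  field
    ⋆-unfoldˡ : ∀ a → 1# + a · (a ⋆) ≤ a ⋆
    ⋆-inductˡ : ∀ a b c → b + a · c ≤ c → (a ⋆) · b ≤ c
    ⋆-unfoldʳ : ∀ a → 1# + (a ⋆) · a ≤ a ⋆
    ⋆-inductʳ : ∀ a b c → b + c · a ≤ c → b · (a ⋆) ≤ c

  IsTest : S → Set c
  IsTest p = p ≤ 1# × Σ S (λ q → (p + q ≡ 1#) × (p · q ≡ 0#) × (q · p ≡ 0#))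

  Test : Set c
  Test = Σ S IsTest

  val : Test → S
  val = proj₁

  ¬ₜ : Test → S
  ¬ₜ (_ , _ , q , _) = q

  field
    fdia : S → Test → Test
    bdia : S → Test → Test
    fdia-adj : ∀ a (p q : Test) →
      (val (fdia a p) ≤ val q) ⇔ (¬ₜ q · a · val p ≤ 0#)
    bdia-adj : ∀ a (p q : Test) →
      (val (bdia a p) ≤ val q) ⇔ (val p · a · ¬ₜ q ≤ 0#)
    fdia-comp : ∀ a b (p : Test) → val (fdia (a · b) p) ≡ val (fdia a (fdia b p))
    bdia-comp : ∀ a b (p : Test) → val (bdia (a · b) p) ≡ val (bdia b (bdia a p))
    ∇ : S → Test
    ∇-unfold : ∀ a → val (∇ a) ≤ val (fdia a (∇ a))
    ∇-induct : ∀ a (p : Test) → val p ≤ val (fdia a p) → val p ≤ val (∇ a)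

  _-ₜ_ : Test → Test → S
  p -ₜ q = val p · ¬ₜ q

  Noetherian : S → Set c
  Noetherian c = ∀ (p : Test) → p -ₜ fdia c p ≤ 0# → val p ≤ 0#

  -- a d-quasi-commutes over b:  |b⟩|a⟩ ≤ |a⟩|(a+b)*⟩  (pointwise on tests)
  DQuasiCommutes : S → S → Set c
  DQuasiCommutes a b =
    ∀ (p : Test) → val (fdia b (fdia a p)) ≤ val (fdia a (fdia ((a + b) ⋆) p))

module Submission where

-- Write C = (a + b)⋆.  From the d-quasi-commutation
-- |b⟩|a⟩ ≤ |a⟩|C⟩ one obtains, by star induction on diamonds, the stronger
-- commutation |C⟩|a⟩ ≤ |a⟩|C⟩: the test |a⟩|C⟩y is closed under both |a⟩ and
-- |b⟩, hence under |a + b⟩ and under |C⟩.  Now let p ≤ |b⋆a⟩p and put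
-- q = |C⟩p.  Since C·b⋆ ≤ C,
--     q ≤ |C⟩|b⋆⟩|a⟩p ≤ |C⟩|a⟩p ≤ |a⟩|C⟩p = |a⟩q,
-- so q ≤ 0 by Noetherianity of a, and p ≤ q because 1 ≤ C.

open import Defs
open import Level using (Level)
open import Data.Product using (_,_)
open import Function using (Equivalence)
open import Relation.Binary.Bundles using (Poset)
open import Relation.Binary.PropositionalEquality
  using (_≡_; refl; sym; trans; cong; isEquivalence; module ≡-Reasoning)

module Theory {c : Level} (K : DivergenceKleeneAlgebra c) where
  open DivergenceKleeneAlgebra K

  ≤-trans : ∀ {x y z} → x ≤ y → y ≤ z → x ≤ z
  ≤-trans {x} {y} {z} x≤y y≤z = begin
    x + z         ≡⟨ cong (x +_) y≤z ⟨
    x + (y + z)   ≡⟨ +-assoc x y z ⟨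
    (x + y) + z   ≡⟨ cong (_+ z) x≤y ⟩
    y + z         ≡⟨ y≤z ⟩
    z             ∎
    where open ≡-Reasoning

  ≤-poset : Poset c c c
  ≤-poset = record
    { _≈_ = _≡_
    ; _≤_ = _≤_
    ; isPartialOrder = record
      { isPreorder = record
        { isEquivalence = isEquivalence
        ; reflexive     = λ { {x} refl → +-idem x }
        ; trans         = ≤-trans
        }
      ; antisym = λ {x} {y} x≤y y≤x → trans (sym y≤x) (trans (+-comm y x) x≤y)
      }
    }

  open Poset ≤-poset public using () renaming (refl to ≤-refl; reflexive to ≡⇒≤)
  open import Relation.Binary.Reasoning.PartialOrder ≤-poset

  +-identʳ : ∀ x → x + 0# ≡ x
  +-identʳ x = trans (+-comm x 0#) (+-identˡ x)

  x≤x+y : ∀ x y → x ≤ x + y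
  x≤x+y x y = trans (sym (+-assoc x x y)) (cong (_+ y) (+-idem x))

  y≤x+y : ∀ x y → y ≤ x + y
  y≤x+y x y = ≤-trans (x≤x+y y x) (≡⇒≤ (+-comm y x))

  +-lub : ∀ {x y z} → x ≤ z → y ≤ z → x + y ≤ z
  +-lub {x} {y} {z} x≤z y≤z = trans (+-assoc x y z) (trans (cong (x +_) y≤z) x≤z)

  ·-monoʳ : ∀ w {x y} → x ≤ y → w · x ≤ w · y
  ·-monoʳ w {x} {y} x≤y = trans (sym (distribˡ w x y)) (cong (w ·_) x≤y)

  ·-monoˡ : ∀ w {x y} → x ≤ y → x · w ≤ y · w
  ·-monoˡ w {x} {y} x≤y = trans (sym (distribʳ w x y)) (cong (_· w) x≤y)

  ≤0⇒≡0 : ∀ {x} → x ≤ 0# → x ≡ 0#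
  ≤0⇒≡0 {x} x≤0 = trans (sym (+-identʳ x)) x≤0

  1≤⋆ : ∀ x → 1# ≤ x ⋆
  1≤⋆ x = ≤-trans (x≤x+y 1# (x · x ⋆)) (⋆-unfoldˡ x)

  x·x⋆≤x⋆ : ∀ x → x · x ⋆ ≤ x ⋆
  x·x⋆≤x⋆ x = ≤-trans (y≤x+y 1# (x · x ⋆)) (⋆-unfoldˡ x)

  x⋆·x≤x⋆ : ∀ x → x ⋆ · x ≤ x ⋆
  x⋆·x≤x⋆ x = ≤-trans (y≤x+y 1# (x ⋆ · x)) (⋆-unfoldʳ x)

  ≤⇒·⋆-absorb : ∀ {x y} → y ≤ x → y · x ⋆ ≤ x ⋆
  ≤⇒·⋆-absorb {x} y≤x = ≤-trans (·-monoˡ (x ⋆) y≤x) (x·x⋆≤x⋆ x)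

  ⋆-absorbʳ : ∀ {x y} → y ≤ x → x ⋆ · y ⋆ ≤ x ⋆
  ⋆-absorbʳ {x} {y} y≤x = ⋆-inductʳ y (x ⋆) (x ⋆)
    (+-lub ≤-refl (≤-trans (·-monoʳ (x ⋆) y≤x) (x⋆·x≤x⋆ x)))

  ⋆-simulation : ∀ k z → k · z ≤ z · k → k ⋆ · z ≤ z · k ⋆
  ⋆-simulation k z kz≤zk = ⋆-inductˡ k z (z · k ⋆) (+-lub z≤zk⋆ kzk⋆≤zk⋆)
    where
    z≤zk⋆ : z ≤ z · k ⋆
    z≤zk⋆ = begin
      z        ≡⟨ ·-identʳ z ⟨
      z · 1#   ≤⟨ ·-monoʳ z (1≤⋆ k) ⟩
      z · k ⋆  ∎
    kzk⋆≤zk⋆ : k · (z · k ⋆) ≤ z · k ⋆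
    kzk⋆≤zk⋆ = begin
      k · (z · k ⋆)   ≡⟨ ·-assoc k z (k ⋆) ⟨
      (k · z) · k ⋆   ≤⟨ ·-monoˡ (k ⋆) kz≤zk ⟩
      (z · k) · k ⋆   ≡⟨ ·-assoc z k (k ⋆) ⟩
      z · (k · k ⋆)   ≤⟨ ·-monoʳ z (x·x⋆≤x⋆ k) ⟩
      z · k ⋆         ∎

  test≤1 : ∀ (p : Test) → val p ≤ 1#
  test≤1 (_ , p≤1 , _) = p≤1

  test-sum : ∀ (p : Test) → val p + ¬ₜ p ≡ 1#
  test-sum (_ , _ , _ , p+¬p , _ , _) = p+¬p

  test-disjointʳ : ∀ (p : Test) → val p · ¬ₜ p ≡ 0#
  test-disjointʳ (_ , _ , _ , _ , p¬p , _) = p¬p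

  test-disjointˡ : ∀ (p : Test) → ¬ₜ p · val p ≡ 0#
  test-disjointˡ (_ , _ , _ , _ , _ , ¬pp) = ¬pp

  guardˡ : ∀ (p : Test) x → ¬ₜ p · x ≤ 0# → x ≡ val p · x
  guardˡ p x ¬px≤0 = begin-equality
    x                          ≡⟨ ·-identˡ x ⟨
    1# · x                     ≡⟨ cong (_· x) (test-sum p) ⟨
    (val p + ¬ₜ p) · x         ≡⟨ distribʳ x (val p) (¬ₜ p) ⟩
    val p · x + ¬ₜ p · x       ≡⟨ cong (val p · x +_) (≤0⇒≡0 ¬px≤0) ⟩
    val p · x + 0#             ≡⟨ +-identʳ (val p · x) ⟩
    val p · x                  ∎

  guardʳ : ∀ (p : Test) x → x · ¬ₜ p ≤ 0# → x ≡ x · val p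
  guardʳ p x x¬p≤0 = begin-equality
    x                          ≡⟨ ·-identʳ x ⟨
    x · 1#                     ≡⟨ cong (x ·_) (test-sum p) ⟨
    x · (val p + ¬ₜ p)         ≡⟨ distribˡ x (val p) (¬ₜ p) ⟩
    x · val p + x · ¬ₜ p       ≡⟨ cong (x · val p +_) (≤0⇒≡0 x¬p≤0) ⟩
    x · val p + 0#             ≡⟨ +-identʳ (x · val p) ⟩
    x · val p                  ∎

  ≤-via-¬ˡ : ∀ (p q : Test) → ¬ₜ q · val p ≤ 0# → val p ≤ val q
  ≤-via-¬ˡ p q ¬qp≤0 = begin
    val p            ≡⟨ guardˡ q (val p) ¬qp≤0 ⟩
    val q · val p    ≤⟨ ·-monoʳ (val q) (test≤1 p) ⟩
    val q · 1#       ≡⟨ ·-identʳ (val q) ⟩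
    val q            ∎

  ≤-via-¬ʳ : ∀ (p q : Test) → p -ₜ q ≤ 0# → val p ≤ val q
  ≤-via-¬ʳ p q p¬q≤0 = begin
    val p            ≡⟨ guardʳ q (val p) p¬q≤0 ⟩
    val p · val q    ≤⟨ ·-monoˡ (val q) (test≤1 p) ⟩
    1# · val q       ≡⟨ ·-identˡ (val q) ⟩
    val q            ∎

  ≤⇒-ₜ≤0 : ∀ (p q : Test) → val p ≤ val q → p -ₜ q ≤ 0#
  ≤⇒-ₜ≤0 p q p≤q = begin
    val p · ¬ₜ q     ≤⟨ ·-monoˡ (¬ₜ q) p≤q ⟩
    val q · ¬ₜ q     ≡⟨ test-disjointʳ q ⟩
    0#               ∎

  fdia-intro : ∀ a (p q : Test) → ¬ₜ q · a · val p ≤ 0# → val (fdia a p) ≤ val q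
  fdia-intro a p q = Equivalence.from (fdia-adj a p q)

  fdia-elim : ∀ a (p : Test) → ¬ₜ (fdia a p) · a · val p ≤ 0#
  fdia-elim a p = Equivalence.to (fdia-adj a p (fdia a p)) ≤-refl

  fdia-monoᵗ : ∀ a {p q : Test} → val p ≤ val q → val (fdia a p) ≤ val (fdia a q)
  fdia-monoᵗ a {p} {q} p≤q =
    fdia-intro a p (fdia a q) (≤-trans (·-monoʳ _ p≤q) (fdia-elim a q))

  fdia-monoᵉ : ∀ {a b} (p : Test) → a ≤ b → val (fdia a p) ≤ val (fdia b p)
  fdia-monoᵉ {a} {b} p a≤b =
    fdia-intro a p (fdia b p) (≤-trans (·-monoˡ (val p) (·-monoʳ _ a≤b)) (fdia-elim b p))

  fdia-absorb : ∀ {x y w} (p : Test) → x · y ≤ w →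
                val (fdia x (fdia y p)) ≤ val (fdia w p)
  fdia-absorb {x} {y} p xy≤w = ≤-trans (≡⇒≤ (sym (fdia-comp x y p))) (fdia-monoᵉ p xy≤w)

  p≤fdia⋆ : ∀ x (p : Test) → val p ≤ val (fdia (x ⋆) p)
  p≤fdia⋆ x p = ≤-trans p≤fdia1 (fdia-monoᵉ p (1≤⋆ x))
    where
    p≤fdia1 : val p ≤ val (fdia 1# p)
    p≤fdia1 = ≤-via-¬ˡ p (fdia 1# p)
      (≤-trans (≡⇒≤ (sym (cong (_· val p) (·-identʳ _)))) (fdia-elim 1# p))

  Closed : S → Test → Set c
  Closed a z = val (fdia a z) ≤ val z

  closed-elim : ∀ a (z : Test) → Closed a z → ¬ₜ z · a · val z ≤ 0#
  closed-elim a z = Equivalence.to (fdia-adj a z z)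

  closed-+ : ∀ a b (z : Test) → Closed a z → Closed b z → Closed (a + b) z
  closed-+ a b z za zb = fdia-intro (a + b) z z (begin
    ¬ₜ z · (a + b) · val z                ≡⟨ cong (_· val z) (distribˡ (¬ₜ z) a b) ⟩
    (¬ₜ z · a + ¬ₜ z · b) · val z         ≡⟨ distribʳ (val z) _ _ ⟩
    ¬ₜ z · a · val z + ¬ₜ z · b · val z   ≤⟨ +-lub (closed-elim a z za) (closed-elim b z zb) ⟩
    0#                                    ∎)

  closed⇒commutes : ∀ k (z : Test) → Closed k z → k · val z ≤ val z · k
  closed⇒commutes k z zk = begin
    k · val z               ≡⟨ guardˡ z (k · val z) ¬zkz≤0 ⟩
    val z · (k · val z)     ≡⟨ ·-assoc (val z) k (val z) ⟨
    (val z · k) · val z     ≤⟨ ·-monoʳ (val z · k) (test≤1 z) ⟩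
    (val z · k) · 1#        ≡⟨ ·-identʳ (val z · k) ⟩
    val z · k               ∎
    where
    ¬zkz≤0 : ¬ₜ z · (k · val z) ≤ 0#
    ¬zkz≤0 = ≤-trans (≡⇒≤ (sym (·-assoc (¬ₜ z) k (val z))))
                     (closed-elim k z zk)

  closed-⋆ : ∀ k (z : Test) → Closed k z → Closed (k ⋆) z
  closed-⋆ k z zk = fdia-intro (k ⋆) z z (begin
    ¬ₜ z · k ⋆ · val z       ≡⟨ ·-assoc (¬ₜ z) (k ⋆) (val z) ⟩
    ¬ₜ z · (k ⋆ · val z)     ≤⟨ ·-monoʳ (¬ₜ z) (⋆-simulation k (val z) (closed⇒commutes k z zk)) ⟩
    ¬ₜ z · (val z · k ⋆)     ≡⟨ ·-assoc (¬ₜ z) (val z) (k ⋆) ⟨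
    ¬ₜ z · val z · k ⋆       ≡⟨ cong (_· k ⋆) (test-disjointˡ z) ⟩
    0# · k ⋆                 ≡⟨ zeroˡ (k ⋆) ⟩
    0#                       ∎)

  noetherian-intro : ∀ c → (∀ (p : Test) → val p ≤ val (fdia c p) → val p ≤ 0#) →
                     Noetherian c
  noetherian-intro c no-fixpoint p p-|c⟩p≤0 = no-fixpoint p (≤-via-¬ʳ p (fdia c p) p-|c⟩p≤0)

  noetherian-elim : ∀ {c} → Noetherian c → ∀ (p : Test) → val p ≤ val (fdia c p) → val p ≤ 0#
  noetherian-elim {c} noeth p p≤|c⟩p = noeth p (≤⇒-ₜ≤0 p (fdia c p) p≤|c⟩p)

  ⋆-commutation : ∀ a b → DQuasiCommutes a b → ∀ (y : Test) →
                  val (fdia ((a + b) ⋆) (fdia a y)) ≤ val (fdia a (fdia ((a + b) ⋆) y))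
  ⋆-commutation a b dqc y = begin
    val (fdia C (fdia a y))  ≤⟨ fdia-monoᵗ C (fdia-monoᵗ a (p≤fdia⋆ (a + b) y)) ⟩
    val (fdia C z)           ≤⟨ closed-⋆ (a + b) z (closed-+ a b z z-closed-a z-closed-b) ⟩
    val z                    ∎
    where
    C : S
    C = (a + b) ⋆
    -- the test |a⟩|C⟩y is closed under a (as aC ≤ C) and under b (by
    -- quasi-commutation and CC ≤ C), hence under C
    z : Test
    z = fdia a (fdia C y)
    z-closed-a : Closed a z
    z-closed-a = fdia-monoᵗ a (fdia-absorb y (≤⇒·⋆-absorb (x≤x+y a b)))
    z-closed-b : Closed b z
    z-closed-b = ≤-trans (dqc (fdia C y)) (fdia-monoᵗ a (fdia-absorb y (⋆-absorbʳ ≤-refl)))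

lemma10p5 : {c : Level} (K : DivergenceKleeneAlgebra c) →
    let open DivergenceKleeneAlgebra K in
    ∀ (a b : S) → DQuasiCommutes a b → Noetherian a → Noetherian ((b ⋆) · a)
lemma10p5 K a b dqc noeth = noetherian-intro (b ⋆ · a) λ p p≤|b⋆a⟩p →
  ≤-trans (p≤fdia⋆ (a + b) p) (noetherian-elim noeth (fdia C p) (|C⟩p≤|a⟩|C⟩p p p≤|b⋆a⟩p))
  where
  open DivergenceKleeneAlgebra K
  open Theory K
  open import Relation.Binary.Reasoning.PartialOrder ≤-poset

  C : S
  C = (a + b) ⋆

  |C⟩p≤|a⟩|C⟩p : ∀ (p : Test) → val p ≤ val (fdia (b ⋆ · a) p) →
                 val (fdia C p) ≤ val (fdia a (fdia C p))
  |C⟩p≤|a⟩|C⟩p p p≤|b⋆a⟩p = begin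
    val (fdia C p)                       ≤⟨ fdia-monoᵗ C p≤|b⋆a⟩p ⟩
    val (fdia C (fdia (b ⋆ · a) p))      ≤⟨ fdia-monoᵗ C (≡⇒≤ (fdia-comp (b ⋆) a p)) ⟩
    val (fdia C (fdia (b ⋆) (fdia a p))) ≤⟨ fdia-absorb (fdia a p) (⋆-absorbʳ (y≤x+y a b)) ⟩
    val (fdia C (fdia a p))              ≤⟨ ⋆-commutation a b dqc p ⟩
    val (fdia a (fdia C p))              ∎
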